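{- For every dialogue tree $d\in\mathcal{D}_{\mathbb N}\mathbb{N}$, we have $\mathsf{maxBQ}(\mathsf{prune}\,d)=[\![\mathsf{maxBQ}^T]\!]\,(\mathsf{enc}_\iota\,d)$.
   Context: Metatheory: constructive Martin-Löf type theory without function extensionality; $\mathbb{B}$ is the booleans, $\mathsf{emb}:\mathbb{B}\to\mathbb{N}$ maps $\mathsf{false}\mapsto0$, $\mathsf{true}\mapsto1$. System T types: base $\iota$ and $\sigma\Rightarrow\tau$; standard terms and set interpretation $[\![\iota]\!]=\mathbb{N}$, $[\![\sigma\Rightarrow\tau]\!]=[\![\sigma]\!]\to[\![\tau]\!]$; numerals $\underline0=\mathsf{zero}$, $\underline{n+1}=\mathsf{succ}\,\underline n$. Dialogue trees $\mathcal{D}(I,O,X)$: inductive, constructors $\eta\,x$ ($x:X$) and $\beta\,\varphi\,i$ ($\varphi:O\to\mathcal{D}(I,O,X)$, $i:I$); $\mathcal{D}_{\mathbb N}\mathbb{N}:=\mathcal{D}(\mathbb{N},\mathbb{N},\mathbb{N})$. $\mathsf{prune}:\mathcal{D}_{\mathbb N}\mathbb{N}\to\mathcal{D}(\mathbb{N},\mathbb{B},\mathbb{N})$: $\mathsf{prune}(\eta\,n)=\eta\,n$, $\mathsf{prune}(\beta\,\varphi\,n)=\beta\,(\mathsf{prune}\circ\varphi\circ\mathsf{emb})\,n$. $\mathsf{maxBQ}:\mathcal{D}(\mathbb{N},\mathbb{B},\mathbb{N})\to\mathbb{N}$: $\mathsf{maxBQ}(\eta\,n)=0$, $\mathsf{maxBQ}(\beta\,\varphi\,n)=\max(n,\max(\mathsf{maxBQ}(\varphi\,\mathsf{false}),\mathsf{maxBQ}(\varphi\,\mathsf{true})))$.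 Internal trees: $\mathsf{ChD}_A(\sigma):=(\sigma\Rightarrow A)\Rightarrow((\iota\Rightarrow A)\Rightarrow\iota\Rightarrow A)\Rightarrow A$; $\eta_A:=\lambda z\,e\,b.\,e\,z$; $\beta_A:=\lambda\varphi\,x\,e\,b.\,b(\lambda y.\varphi\,y\,e\,b)\,x$. Encoding $\mathsf{enc}_A(\eta\,z)=[\![\eta_A]\!]z$, $\mathsf{enc}_A(\beta\,\varphi\,x)=[\![\beta_A]\!](\mathsf{enc}_A\circ\varphi)\,x$. Fix closed $\mathsf{max}^T:\iota\Rightarrow\iota\Rightarrow\iota$ with $[\![\mathsf{max}^T]\!]\,a\,b=\max(a,b)$; $\mathsf{maxBQ}^T:=\lambda d.\,d\,(\lambda w.\mathsf{zero})\,(\lambda g\,x.\,\mathsf{max}^T\,x\,(\mathsf{max}^T\,(g\,\underline0)\,(g\,\underline1)))$ of type $\mathsf{ChD}_\iota(\iota)\Rightarrow\iota$. -}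

module Defs where

open import Data.Nat using (ℕ; zero; suc; _⊔_)
open import Data.Bool using (Bool; true; false)

data D (I O X : Set) : Set where
  η : X → D I O X
  β : (O → D I O X) → I → D I O X

Dℕℕ : Set
Dℕℕ = D ℕ ℕ ℕ

emb : Bool → ℕ
emb false = 0
emb true  = 1

prune : Dℕℕ → D ℕ Bool ℕ
prune (η n)   = η n
prune (β φ n) = β (λ b → prune (φ (emb b))) n

maxBQ : D ℕ Bool ℕ → ℕ
maxBQ (η n)   = 0
maxBQ (β φ n) = n ⊔ (maxBQ (φ false) ⊔ maxBQ (φ true))

infixr 30 _⇒_
data Ty : Set where
  ι   : Ty
  _⇒_ : Ty → Ty → Ty

data Cxt : Set where
  ε   : Cxt
  _,_ : Cxt → Ty → Cxt

data _∈_ : Ty → Cxt → Set where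
  here  : ∀ {Γ σ} → σ ∈ (Γ , σ)
  there : ∀ {Γ σ τ} → σ ∈ Γ → σ ∈ (Γ , τ)

data Tm (Γ : Cxt) : Ty → Set where
  var  : ∀ {σ} → σ ∈ Γ → Tm Γ σ
  lam  : ∀ {σ τ} → Tm (Γ , σ) τ → Tm Γ (σ ⇒ τ)
  app  : ∀ {σ τ} → Tm Γ (σ ⇒ τ) → Tm Γ σ → Tm Γ τ
  Zero : Tm Γ ι
  Succ : Tm Γ (ι ⇒ ι)
  Rec  : ∀ {σ} → Tm Γ ((ι ⇒ σ ⇒ σ) ⇒ σ ⇒ ι ⇒ σ)

⟦_⟧ᵀ : Ty → Set
⟦ ι ⟧ᵀ     = ℕ
⟦ σ ⇒ τ ⟧ᵀ = ⟦ σ ⟧ᵀ → ⟦ τ ⟧ᵀ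

data Env : Cxt → Set where
  []  : Env ε
  _∷_ : ∀ {Γ σ} → Env Γ → ⟦ σ ⟧ᵀ → Env (Γ , σ)

lookupEnv : ∀ {Γ σ} → Env Γ → σ ∈ Γ → ⟦ σ ⟧ᵀ
lookupEnv (ρ ∷ x) here      = x
lookupEnv (ρ ∷ x) (there i) = lookupEnv ρ i

rec : {A : Set} → (ℕ → A → A) → A → ℕ → A
rec f a zero    = a
rec f a (suc n) = f n (rec f a n)

⟦_⟧ₑ : ∀ {Γ σ} → Tm Γ σ → Env Γ → ⟦ σ ⟧ᵀ
⟦ var i ⟧ₑ ρ   = lookupEnv ρ i
⟦ lam t ⟧ₑ ρ   = λ x → ⟦ t ⟧ₑ (ρ ∷ x)
⟦ app t u ⟧ₑ ρ = ⟦ t ⟧ₑ ρ (⟦ u ⟧ₑ ρ)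
⟦ Zero ⟧ₑ ρ    = zero
⟦ Succ ⟧ₑ ρ    = suc
⟦ Rec ⟧ₑ ρ     = rec

⟦_⟧ : ∀ {σ} → Tm ε σ → ⟦ σ ⟧ᵀ
⟦ t ⟧ = ⟦ t ⟧ₑ []

numeral : ∀ {Γ} → ℕ → Tm Γ ι
numeral zero    = Zero
numeral (suc n) = app Succ (numeral n)

wkVar : ∀ {Γ Δ σ} → (∀ {τ} → τ ∈ Γ → τ ∈ Δ) → σ ∈ Γ → σ ∈ Δ
wkVar f i = f i

ext : ∀ {Γ Δ σ} → (∀ {τ} → τ ∈ Γ → τ ∈ Δ) → ∀ {τ} → τ ∈ (Γ , σ) → τ ∈ (Δ , σ)
ext f here      = here
ext f (there i) = there (f i)

rename : ∀ {Γ Δ σ} → (∀ {τ} → τ ∈ Γ → τ ∈ Δ) → Tm Γ σ → Tm Δ σ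
rename f (var i)   = var (f i)
rename f (lam t)   = lam (rename (ext f) t)
rename f (app t u) = app (rename f t) (rename f u)
rename f Zero      = Zero
rename f Succ      = Succ
rename f Rec       = Rec

closed : ∀ {Γ σ} → Tm ε σ → Tm Γ σ
closed = rename (λ ())

-- Internal (Church-encoded) dialogue trees
ChD : Ty → Ty → Ty
ChD A σ = (σ ⇒ A) ⇒ ((ι ⇒ A) ⇒ ι ⇒ A) ⇒ A

v0 : ∀ {Γ σ} → Tm (Γ , σ) σ
v0 = var here
v1 : ∀ {Γ σ τ} → Tm ((Γ , σ) , τ) σ
v1 = var (there here)
v2 : ∀ {Γ σ τ ρ} → Tm (((Γ , σ) , τ) , ρ) σ
v2 = var (there (there here))
v3 : ∀ {Γ σ τ ρ μ} → Tm ((((Γ , σ) , τ) , ρ) , μ) σ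
v3 = var (there (there (there here)))

-- η_A := λ z e b. e z
ηᵀ : (A : Ty) → Tm ε (ι ⇒ ChD A ι)
ηᵀ A = lam (lam (lam (app v1 v2)))

-- β_A := λ φ x e b. b (λ y. φ y e b) x
βᵀ : (A : Ty) → Tm ε ((ι ⇒ ChD A ι) ⇒ ι ⇒ ChD A ι)
βᵀ A = lam (lam (lam (lam
         (app (app v0 (lam (app (app (app (var (there (there (there (there here))))) v0)
                                      (var (there (there here))))
                                 (var (there here)))))
              v2))))

enc : (A : Ty) → Dℕℕ → ⟦ ChD A ι ⟧ᵀ
enc A (η z)   = ⟦ ηᵀ A ⟧ z
enc A (β φ x) = ⟦ βᵀ A ⟧ (λ y → enc A (φ y)) x

-- maxBQ^T := λ d. d (λ w. zero) (λ g x. max^T x (max^T (g 0) (g 1)))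
maxBQᵀ : Tm ε (ι ⇒ ι ⇒ ι) → Tm ε (ChD ι ι ⇒ ι)
maxBQᵀ mx = lam (app (app v0 (lam Zero))
                 (lam (lam (app (app (closed mx) v0)
                   (app (app (closed mx) (app v1 (numeral 0)))
                        (app v1 (numeral 1)))))))

-- Evaluating enc ι d at the leaf case λ _ → 0 and a node case b folds d, and the
-- fold with b g x = x ⊔ (g 0 ⊔ g 1) is maxBQ ∘ prune.  The only work is to see
-- that the node case written in maxBQᵀ really is that function: it uses maxᵀ
-- weakened under binders, and without function extensionality the value of a
-- weakened term agrees with the original only pointwise, which is what a
-- logical relation for renaming provides.
module Submission where

open import Defs
open import Data.Nat using (ℕ; _⊔_; zero; suc)
open import Relation.Binary.PropositionalEquality using (_≡_; refl; cong; cong₂; trans; sym)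

Related : (σ : Ty) → ⟦ σ ⟧ᵀ → ⟦ σ ⟧ᵀ → Set
Related ι       a b = a ≡ b
Related (σ ⇒ τ) f g = ∀ x y → Related σ x y → Related τ (f x) (g y)

Renaming : Cxt → Cxt → Set
Renaming Γ Δ = ∀ {τ} → τ ∈ Γ → τ ∈ Δ

EnvRelated : ∀ {Γ Δ} → Renaming Γ Δ → Env Δ → Env Γ → Set
EnvRelated {Γ} f ρ ρ′ = ∀ {τ} (i : τ ∈ Γ) → Related τ (lookupEnv ρ (f i)) (lookupEnv ρ′ i)

rec-related : ∀ {σ} f g a b → Related (ι ⇒ σ ⇒ σ) f g → Related σ a b →
  ∀ n → Related σ (rec f a n) (rec g b n)
rec-related f g a b fg ab zero    = ab
rec-related f g a b fg ab (suc n) = fg n n refl _ _ (rec-related f g a b fg ab n)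

rename-related : ∀ {Γ Δ σ} (f : Renaming Γ Δ) (t : Tm Γ σ) (ρ : Env Δ) (ρ′ : Env Γ) →
  EnvRelated f ρ ρ′ → Related σ (⟦ rename f t ⟧ₑ ρ) (⟦ t ⟧ₑ ρ′)
rename-related f (var i)   ρ ρ′ ρρ′ = ρρ′ i
rename-related f (lam t)   ρ ρ′ ρρ′ = λ x y xy →
  rename-related (ext f) t (ρ ∷ x) (ρ′ ∷ y) λ { here → xy ; (there i) → ρρ′ i }
rename-related f (app t u) ρ ρ′ ρρ′ =
  rename-related f t ρ ρ′ ρρ′ _ _ (rename-related f u ρ ρ′ ρρ′)
rename-related f Zero      ρ ρ′ ρρ′ = refl
rename-related f Succ      ρ ρ′ ρρ′ = λ _ _ → cong suc
rename-related f Rec       ρ ρ′ ρρ′ = λ { g g′ gg′ a a′ aa′ n .n refl → rec-related g g′ a a′ gg′ aa′ n }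

closed-related : ∀ {Γ σ} (t : Tm ε σ) (ρ : Env Γ) → Related σ (⟦ closed t ⟧ₑ ρ) ⟦ t ⟧
closed-related t ρ = rename-related (λ ()) t ρ [] (λ ())

maxBQ-prune-enc : (node : (ℕ → ℕ) → ℕ → ℕ) → (∀ g x → node g x ≡ x ⊔ (g 0 ⊔ g 1)) →
  (d : Dℕℕ) → maxBQ (prune d) ≡ enc ι d (λ _ → zero) node
maxBQ-prune-enc node node-spec (η n)   = refl
maxBQ-prune-enc node node-spec (β φ n) = trans
  (cong₂ (λ p q → n ⊔ (p ⊔ q)) (maxBQ-prune-enc node node-spec (φ 0))
                               (maxBQ-prune-enc node node-spec (φ 1)))
  (sym (node-spec (λ y → enc ι (φ y) (λ _ → zero) node) n))

lemma50 : (maxT : Tm ε (ι ⇒ ι ⇒ ι)) → (∀ a b → ⟦ maxT ⟧ a b ≡ a ⊔ b) →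
    (d : Dℕℕ) → maxBQ (prune d) ≡ ⟦ maxBQᵀ maxT ⟧ (enc ι d)
lemma50 maxT maxT-spec d = maxBQ-prune-enc node node-spec d
  where
  node : (ℕ → ℕ) → ℕ → ℕ
  node = ⟦ lam (lam (app (app (closed maxT) v0)
             (app (app (closed maxT) (app v1 (numeral 0))) (app v1 (numeral 1))))) ⟧ₑ ([] ∷ enc ι d)
  ⟦maxT⟧ : ∀ {Γ} (ρ′ : Env Γ) a b → ⟦ closed maxT ⟧ₑ ρ′ a b ≡ a ⊔ b
  ⟦maxT⟧ ρ′ a b = trans (closed-related maxT ρ′ a a refl b b refl) (maxT-spec a b)
  node-spec : ∀ g x → node g x ≡ x ⊔ (g 0 ⊔ g 1)
  node-spec g x = trans (⟦maxT⟧ _ x _) (cong (x ⊔_) (⟦maxT⟧ _ _ _))
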